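{- Let $n, x, p \in \mathbb{N}$ with $n > x \ge p \ge 2$, and let $\{S_1, S_2, \ldots, S_x\}$ be a partition of $I_n = \{1,\ldots,n\}$ with $n_i = |S_i|$ satisfying $1 \le n_1 = n_2 = \cdots = n_p \le n_{p+1} \le \cdots \le n_x$. Let $Q_p = \sum_{j=1}^{p n_1} (n - j + 1)$ and $M = \frac{T_n}{x}$, where $T_n = \frac{n(n+1)}{2}$. If $M > \left\lfloor \frac{Q_p}{p} \right\rfloor$, then $\{S_1, \ldots, S_x\}$ is not a constant sum partition of $I_n$.
   Context: A partition $\{S_1,\ldots,S_x\}$ of $I_n = \{1,\ldots,n\}$ is a grouping of its elements into nonempty pairwise disjoint subsets with union $I_n$. Such a partition is a constant sum partition if $\sum_{a \in S_i} a$ is the same constant for all $i$, $1 \le i \le x$. -}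

module Defs where

open import Data.Nat using (ℕ; zero; suc; _+_; _*_; _∸_; _≤_; _<_)
open import Data.Fin using (Fin; toℕ; _≟_)
import Data.Fin as F
open import Data.Product using (Σ; ∃)
open import Relation.Nullary.Decidable using (does)
open import Data.Bool using (if_then_else_)
open import Relation.Binary.PropositionalEquality using (_≡_)

sumFin : (n : ℕ) → (Fin n → ℕ) → ℕ
sumFin zero    g = 0
sumFin (suc n) g = g F.zero + sumFin n (λ i → g (F.suc i))

-- A partition of I_n = {1,…,n} into x blocks S_1..S_x is encoded by its
-- block-assignment  f : Fin n → Fin x : the element (toℕ i + 1) lies in block f i.
-- Blocks are indexed 0..x-1 (block j corresponds to S_{j+1}).

inBlock : {n x : ℕ} → (Fin n → Fin x) → Fin x → Fin n → ℕ
inBlock f j i = if does (f i ≟ j) then 1 else 0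

blockSize : (n : ℕ) {x : ℕ} → (Fin n → Fin x) → Fin x → ℕ
blockSize n f j = sumFin n (inBlock f j)

blockSum : (n : ℕ) {x : ℕ} → (Fin n → Fin x) → Fin x → ℕ
blockSum n f j = sumFin n (λ i → inBlock f j i * suc (toℕ i))

IsPartition : (n x : ℕ) → (Fin n → Fin x) → Set
IsPartition n x f = (j : Fin x) → ∃ λ i → f i ≡ j

IsConstantSum : (n x : ℕ) → (Fin n → Fin x) → Set
IsConstantSum n x f = (j k : Fin x) → blockSum n f j ≡ blockSum n f k

T : ℕ → ℕ
T n = sumFin n (λ i → suc (toℕ i))

-- Q_p = Σ_{j=1}^{m} (n - j + 1)  with m = p * n_1
Q : (n m : ℕ) → ℕ
Q n m = sumFin m (λ j → n ∸ toℕ j)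

-- Let c be the common block sum. Summing over all x blocks gives T n = x c. The first p blocks
-- together contain p n₁ distinct elements of I_n with total p c, and such a set sums to at most
-- the sum Q_p of the p n₁ largest elements of I_n; hence c ≤ ⌊Q_p / p⌋ so M = T n / x ≤ ⌊Q_p / p⌋.
module Submission where

open import Defs
open import Data.Nat using (ℕ; zero; suc; _+_; _*_; _∸_; _≤_; _<_; z≤n; s≤s; NonZero)
import Data.Nat as N
open import Data.Nat.Properties hiding (_≟_)
open import Data.Nat.DivMod using (m*n/n≡m; /-monoˡ-≤)
open import Data.Fin using (Fin; zero; suc; toℕ; _≟_)
open import Data.Fin.Properties using (toℕ<n)
open import Data.Bool using (if_then_else_)
open import Data.Integer using (+_)
import Data.Integer.Properties as ℤ
import Data.Rational as Q
import Data.Rational.Properties as ℚ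
import Data.Rational.Unnormalised as ℚᵘ
import Data.Rational.Unnormalised.Properties as ℚᵘ
open import Algebra.Properties.CommutativeSemigroup +-commutativeSemigroup using (interchange)
open import Algebra.Properties.CommutativeSemigroup *-commutativeSemigroup using (x∙yz≈y∙xz)
open import Relation.Nullary using (¬_)
open import Relation.Nullary.Decidable using (does)
open import Relation.Binary.PropositionalEquality
  using (_≡_; refl; sym; trans; cong; cong₂; module ≡-Reasoning)

sumFin-cong : ∀ n {g h : Fin n → ℕ} → (∀ i → g i ≡ h i) → sumFin n g ≡ sumFin n h
sumFin-cong zero    eq = refl
sumFin-cong (suc n) eq = cong₂ _+_ (eq zero) (sumFin-cong n (λ i → eq (suc i)))

sumFin-mono : ∀ n {g h : Fin n → ℕ} → (∀ i → g i ≤ h i) → sumFin n g ≤ sumFin n h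
sumFin-mono zero    le = z≤n
sumFin-mono (suc n) le = +-mono-≤ (le zero) (sumFin-mono n (λ i → le (suc i)))

sumFin-const : ∀ n c → sumFin n (λ _ → c) ≡ n * c
sumFin-const zero    c = refl
sumFin-const (suc n) c = cong (_+_ c) (sumFin-const n c)

sumFin-0 : ∀ n → sumFin n (λ _ → 0) ≡ 0
sumFin-0 n = trans (sumFin-const n 0) (*-zeroʳ n)

sumFin-1 : ∀ n → sumFin n (λ _ → 1) ≡ n
sumFin-1 n = trans (sumFin-const n 1) (*-identityʳ n)

sumFin-+ : ∀ n (g h : Fin n → ℕ) → sumFin n (λ i → g i + h i) ≡ sumFin n g + sumFin n h
sumFin-+ zero    g h = refl
sumFin-+ (suc n) g h = trans (cong (_+_ (g zero + h zero)) (sumFin-+ n _ _))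
                             (interchange (g zero) (h zero) _ _)

sumFin-*ˡ : ∀ n (g : Fin n → ℕ) c → sumFin n (λ i → c * g i) ≡ c * sumFin n g
sumFin-*ˡ zero    g c = sym (*-zeroʳ c)
sumFin-*ˡ (suc n) g c = trans (cong (_+_ (c * g zero)) (sumFin-*ˡ n _ c))
                              (sym (*-distribˡ-+ c (g zero) _))

sumFin-swap : ∀ n m (F : Fin n → Fin m → ℕ) →
  sumFin n (λ i → sumFin m (F i)) ≡ sumFin m (λ j → sumFin n (λ i → F i j))
sumFin-swap zero    m F = sym (sumFin-0 m)
sumFin-swap (suc n) m F = trans (cong (_+_ (sumFin m (F zero))) (sumFin-swap n m (λ i → F (suc i))))
                                (sym (sumFin-+ m (F zero) _))

sumFin-δ : ∀ x (a : Fin x) (u : Fin x → ℕ) →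
  sumFin x (λ j → (if does (a ≟ j) then 1 else 0) * u j) ≡ u a
sumFin-δ (suc x) zero    u = trans (cong₂ _+_ (+-identityʳ (u zero)) (sumFin-0 x))
                                   (+-identityʳ (u zero))
sumFin-δ (suc x) (suc a) u = sumFin-δ x a (λ j → u (suc j))

sumFin-blocks : ∀ n x (f : Fin n → Fin x) (h : Fin x → ℕ) (w : Fin n → ℕ) →
  sumFin x (λ j → h j * sumFin n (λ i → inBlock f j i * w i)) ≡ sumFin n (λ i → h (f i) * w i)
sumFin-blocks n x f h w = begin
  sumFin x (λ j → h j * sumFin n (λ i → inBlock f j i * w i))
    ≡⟨ sumFin-cong x (λ j → sym (sumFin-*ˡ n _ (h j))) ⟩
  sumFin x (λ j → sumFin n (λ i → h j * (inBlock f j i * w i)))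
    ≡⟨ sym (sumFin-swap n x _) ⟩
  sumFin n (λ i → sumFin x (λ j → h j * (inBlock f j i * w i)))
    ≡⟨ sumFin-cong n (λ i → sumFin-cong x (λ j → x∙yz≈y∙xz (h j) (inBlock f j i) (w i))) ⟩
  sumFin n (λ i → sumFin x (λ j → inBlock f j i * (h j * w i)))
    ≡⟨ sumFin-cong n (λ i → sumFin-δ x (f i) (λ j → h j * w i)) ⟩
  sumFin n (λ i → h (f i) * w i) ∎
  where open ≡-Reasoning

sumFin-blockSum : ∀ n x (f : Fin n → Fin x) (h : Fin x → ℕ) →
  sumFin x (λ j → h j * blockSum n f j) ≡ sumFin n (λ i → h (f i) * suc (toℕ i))
sumFin-blockSum n x f h = sumFin-blocks n x f h (λ i → suc (toℕ i))

sumFin-blockSize : ∀ n x (f : Fin n → Fin x) (h : Fin x → ℕ) →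
  sumFin x (λ j → h j * blockSize n f j) ≡ sumFin n (λ i → h (f i))
sumFin-blockSize n x f h = begin
  sumFin x (λ j → h j * blockSize n f j)
    ≡⟨ sumFin-cong x (λ j → cong (h j *_) (sumFin-cong n (λ i → sym (*-identityʳ _)))) ⟩
  sumFin x (λ j → h j * sumFin n (λ i → inBlock f j i * 1))
    ≡⟨ sumFin-blocks n x f h (λ _ → 1) ⟩
  sumFin n (λ i → h (f i) * 1)
    ≡⟨ sumFin-cong n (λ i → *-identityʳ (h (f i))) ⟩
  sumFin n (λ i → h (f i)) ∎
  where open ≡-Reasoning

T≡x*blockSum : ∀ n x (f : Fin n → Fin x) → IsConstantSum n x f → ∀ j → T n ≡ x * blockSum n f j
T≡x*blockSum n x f constSum j = begin
  T n                                    ≡⟨ sumFin-cong n (λ i → sym (*-identityˡ (suc (toℕ i)))) ⟩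
  sumFin n (λ i → 1 * suc (toℕ i))       ≡⟨ sym (sumFin-blockSum n x f (λ _ → 1)) ⟩
  sumFin x (λ k → 1 * blockSum n f k)    ≡⟨ sumFin-cong x (λ k → cong (1 *_) (constSum k j)) ⟩
  sumFin x (λ _ → 1 * blockSum n f j)    ≡⟨ sumFin-const x _ ⟩
  x * (1 * blockSum n f j)               ≡⟨ cong (x *_) (*-identityˡ _) ⟩
  x * blockSum n f j                     ∎
  where open ≡-Reasoning

below : ℕ → ℕ → ℕ
below zero    _       = 0
below (suc p) zero    = 1
below (suc p) (suc t) = below p t

below≤1 : ∀ p t → below p t ≤ 1
below≤1 zero    t       = z≤n
below≤1 (suc p) zero    = s≤s z≤n
below≤1 (suc p) (suc t) = below≤1 p t

sumFin-below* : ∀ x p (v : Fin x → ℕ) c → p ≤ x → (∀ j → toℕ j < p → v j ≡ c) →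
  sumFin x (λ j → below p (toℕ j) * v j) ≡ p * c
sumFin-below* zero    zero    v c _         _    = refl
sumFin-below* (suc x) zero    v c _         _    = sumFin-below* x zero (λ j → v (suc j)) c z≤n (λ _ ())
sumFin-below* (suc x) (suc p) v c (s≤s p≤x) v≡c =
  cong₂ _+_ (trans (+-identityʳ (v zero)) (v≡c zero (s≤s z≤n)))
            (sumFin-below* x p (λ j → v (suc j)) c p≤x (λ j j<p → v≡c (suc j) (s≤s j<p)))

Q-suc : ∀ n k → k ≤ n → Q (suc n) k ≡ k + Q n k
Q-suc n k k≤n = begin
  sumFin k (λ j → suc n ∸ toℕ j)      ≡⟨ sumFin-cong k (λ j → +-∸-assoc 1 (≤-trans (<⇒≤ (toℕ<n j)) k≤n)) ⟩
  sumFin k (λ j → 1 + (n ∸ toℕ j))    ≡⟨ sumFin-+ k (λ _ → 1) _ ⟩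
  sumFin k (λ _ → 1) + Q n k          ≡⟨ cong (λ s → s + Q n k) (sumFin-1 k) ⟩
  k + Q n k                           ∎
  where open ≡-Reasoning

indicatorSum≤Q : ∀ n (g : Fin n → ℕ) → (∀ i → g i ≤ 1) →
  sumFin n (λ i → g i * suc (toℕ i)) ≤ Q n (sumFin n g)
indicatorSum≤Q zero    g g≤1 = z≤n
indicatorSum≤Q (suc n) g g≤1 = begin
  g zero * 1 + sumFin n (λ i → g′ i * suc (suc (toℕ i)))
    ≡⟨ cong (_+_ (g zero * 1)) (trans (sumFin-cong n (λ i → *-suc (g′ i) _)) (sumFin-+ n g′ _)) ⟩
  g zero * 1 + (k + sumFin n (λ i → g′ i * suc (toℕ i)))
    ≤⟨ +-monoʳ-≤ (g zero * 1) (+-monoʳ-≤ k (indicatorSum≤Q n g′ (λ i → g≤1 (suc i)))) ⟩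
  g zero * 1 + (k + Q n k)
    ≤⟨ insert (g zero) (g≤1 zero) ⟩
  Q (suc n) (g zero + k) ∎
  where
  open ≤-Reasoning
  g′ : Fin n → ℕ
  g′ i = g (suc i)
  k : ℕ
  k = sumFin n g′
  k≤n : k ≤ n
  k≤n = ≤-trans (sumFin-mono n (λ i → g≤1 (suc i))) (≤-reflexive (sumFin-1 n))
  insert : ∀ b → b ≤ 1 → b * 1 + (k + Q n k) ≤ Q (suc n) (b + k)
  insert zero    _         = ≤-reflexive (sym (Q-suc n k k≤n))
  insert (suc _) (s≤s z≤n) = s≤s (+-monoˡ-≤ (Q n k) k≤n)

firstBlocksSum≤Q : ∀ n x p (f : Fin n → Fin x) → p ≤ x → IsConstantSum n x f →
  (j₁ : Fin x) → ((j : Fin x) → toℕ j < p → blockSize n f j ≡ blockSize n f j₁) →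
  p * blockSum n f j₁ ≤ Q n (p * blockSize n f j₁)
firstBlocksSum≤Q n x p f p≤x constSum j₁ sameSize = begin
  p * blockSum n f j₁
    ≡⟨ sym (sumFin-below* x p (blockSum n f) _ p≤x (λ j _ → constSum j j₁)) ⟩
  sumFin x (λ j → h j * blockSum n f j)
    ≡⟨ sumFin-blockSum n x f h ⟩
  sumFin n (λ i → h (f i) * suc (toℕ i))
    ≤⟨ indicatorSum≤Q n (λ i → h (f i)) (λ i → below≤1 p (toℕ (f i))) ⟩
  Q n (sumFin n (λ i → h (f i)))
    ≡⟨ cong (Q n) (sym (sumFin-blockSize n x f h)) ⟩
  Q n (sumFin x (λ j → h j * blockSize n f j))
    ≡⟨ cong (Q n) (sumFin-below* x p (blockSize n f) _ p≤x sameSize) ⟩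
  Q n (p * blockSize n f j₁) ∎
  where
  open ≤-Reasoning
  h : Fin x → ℕ
  h j = below p (toℕ j)

m/1<t/x⇒m*x<t : ∀ m t x .{{_ : NonZero x}} → (+ m) Q./ 1 Q.< (+ t) Q./ x → m * x < t
m/1<t/x⇒m*x<t m t (suc x) lt = unnormalised
  (ℚᵘ.<-respˡ-≃ (ℚ.toℚᵘ-fromℚᵘ (ℚᵘ.mkℚᵘ (+ m) 0))
    (ℚᵘ.<-respʳ-≃ (ℚ.toℚᵘ-fromℚᵘ (ℚᵘ.mkℚᵘ (+ t) x)) (ℚ.toℚᵘ-mono-< lt)))
  where
  unnormalised : ℚᵘ.mkℚᵘ (+ m) 0 ℚᵘ.< ℚᵘ.mkℚᵘ (+ t) x → m * suc x < t
  unnormalised (ℚᵘ.*<* lt′) rewrite ℤ.+◃n≡+n (m * suc x) | ℤ.+◃n≡+n (t * 1) | *-identityʳ t =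
    ℤ.drop‿+<+ lt′

theorem2p6 : (n x p : ℕ) → .{{_ : NonZero x}} → .{{_ : NonZero p}}
    → x < n → p ≤ x → 2 ≤ p
    → (f : Fin n → Fin x) → IsPartition n x f
    → (j₁ : Fin x) → toℕ j₁ ≡ 0
    → ((j : Fin x) → suc (toℕ j) ≤ p → blockSize n f j ≡ blockSize n f j₁)
    → ((j k : Fin x) → p ≤ suc (toℕ j) → toℕ j < toℕ k
         → blockSize n f j ≤ blockSize n f k)
    → (+ (Q n (p * blockSize n f j₁) N./ p)) Q./ 1 Q.< (+ T n) Q./ x
    → ¬ IsConstantSum n x f
theorem2p6 n x p _ p≤x _ f _ j₁ _ sameSize _ M>⌊Qp/p⌋ constSum =
  <⇒≱ (m/1<t/x⇒m*x<t ⌊Qp/p⌋ (T n) x M>⌊Qp/p⌋) (begin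
    T n          ≡⟨ T≡x*blockSum n x f constSum j₁ ⟩
    x * c        ≤⟨ *-monoʳ-≤ x c≤⌊Qp/p⌋ ⟩
    x * ⌊Qp/p⌋   ≡⟨ *-comm x ⌊Qp/p⌋ ⟩
    ⌊Qp/p⌋ * x   ∎)
  where
  open ≤-Reasoning
  c ⌊Qp/p⌋ : ℕ
  c = blockSum n f j₁
  ⌊Qp/p⌋ = Q n (p * blockSize n f j₁) N./ p
  p*c≤Qp : p * c ≤ Q n (p * blockSize n f j₁)
  p*c≤Qp = firstBlocksSum≤Q n x p f p≤x constSum j₁ sameSize
  c≤⌊Qp/p⌋ : c ≤ ⌊Qp/p⌋
  c≤⌊Qp/p⌋ = begin
    c           ≡⟨ sym (m*n/n≡m c p) ⟩
    c * p N./ p ≤⟨ /-monoˡ-≤ p (≤-trans (≤-reflexive (*-comm c p)) p*c≤Qp) ⟩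
    ⌊Qp/p⌋      ∎
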